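{- Let $\mathcal{K}$ be a class of closed transformation monoids (on various carrier sets), and let $\mathcal{G}=\{G(N)\mid N\in\mathcal{K}\}$, where $G(N)$ denotes the group of invertible elements of $N$. Assume that $\overline{H}\in\mathcal{K}$ for every $H\in\mathcal{G}$, where $\overline{H}$ is the closure of $H$ in the full transformation monoid on its carrier. Let $M\subseteq A^A$ be a closed transformation monoid whose group $G=G(M)$ of invertibles is dense in $M$ and has automatic homeomorphicity with respect to $\mathcal{G}$. Then the following are equivalent: (a) For every set $B$ with $|B|=|A|$, every $M'\subseteq B^B$ with $M'\in\mathcal{K}$ and every monoid isomorphism $\theta\colon M\to M'$, the set $\theta[G]$ is dense in $M'$ and $\theta$ is a uniform homeomorphism. (b) $M$ has automatic homeomorphicity with respect to $\mathcal{K}$. (c) For every set $B$ with $|B|=|A|$, every closed $M'\subseteq B^B$ with $M'\in\mathcal{K}$ and every monoid isomorphism $\theta\colon M\to M'$, the map $\theta$ is continuous. (d) For every set $B$ with $|B|=|A|$, all transformation monoids $M_1\subseteq M_2\subseteq B^B$ with $M_1,M_2\in\mathcal{K}$, and all monoid isomorphisms $\phi_i\colon M\to M_i$ ($i=1,2$): if $\phi_1(g)=\phi_2(g)$ for all $g\in G$, then $M_1=M_2$ and $\phi_1=\phi_2$.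
   Context: A transformation monoid on $A$ is a subset of $A^A$ containing $\mathrm{id}_A$ and closed under composition; its group of invertibles consists of those $g$ having some $h$ in the monoid with $g\circ h=h\circ g=\mathrm{id}_A$. $A^A$ carries the topology of pointwise convergence ($A$ discrete); "closed", "dense", "continuous" refer to it, with the uniformity whose basic entourages are $\{(f_1,f_2): f_1\restriction_C=f_2\restriction_C\}$, $C$ finite; a uniform homeomorphism is a bijection that is uniformly continuous in both directions. A permutation group / transformation monoid $F$ on $A$ has automatic homeomorphicity with respect to a class $\mathcal{L}$ of permutation groups / transformation monoids if for every $F'\in\mathcal{L}$ on a set of the same cardinality as $A$, every group / monoid isomorphism $F\to F'$ is a homeomorphism. -}

module Defs where

open import Level using (0ℓ)
open import Data.List using (List; map)
open import Data.List.Relation.Unary.All using (All; []; _∷_)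
import Data.List.Relation.Unary.All as All
open import Data.Product using (Σ; ∃; _×_; _,_; proj₁; proj₂)
open import Function using (_∘_; id; _↔_)
open import Relation.Binary.PropositionalEquality
  using (_≡_; refl; sym; trans; cong; _≗_)

-- Transformation monoids on A: subsets of A → A (closed under pointwise
-- equality, i.e. genuinely subsets of the set A^A), containing id and
-- closed under composition.

record TMonoid (A : Set) : Set₁ where
  field
    mem  : (A → A) → Set
    resp : ∀ {f g} → f ≗ g → mem f → mem g
    id∈  : mem id
    ∘∈   : ∀ {f g} → mem f → mem g → mem (f ∘ g)
open TMonoid public

Elem : {A : Set} → TMonoid A → Set
Elem M = Σ _ (mem M)

SameMembers : {A : Set} → TMonoid A → TMonoid A → Set
SameMembers M N = (∀ f → mem M f → mem N f) × (∀ f → mem N f → mem M f)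

_⊆ₘ_ : {A : Set} → TMonoid A → TMonoid A → Set
M ⊆ₘ N = ∀ f → mem M f → mem N f

-- Topology of pointwise convergence: basic neighbourhoods are given by
-- agreement on finite sets C (lists).

Agree : {A : Set} → List A → (A → A) → (A → A) → Set
Agree C f g = All (λ a → f a ≡ g a) C

Invertible : {A : Set} → TMonoid A → (A → A) → Set
Invertible M g = ∃ λ h → mem M h × ((g ∘ h) ≗ id) × ((h ∘ g) ≗ id)

Units : {A : Set} → TMonoid A → TMonoid A
Units M = record
  { mem  = λ g → mem M g × Invertible M g
  ; resp = λ {f} {g} e (m , h , hm , fh , hf) →
      resp M e m , h , hm , (λ a → trans (sym (e (h a))) (fh a))
                          , (λ a → trans (cong h (sym (e a))) (hf a))
  ; id∈  = id∈ M , id , id∈ M , (λ _ → refl) , (λ _ → refl)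
  ; ∘∈   = λ {f} {g} (mf , hf , mhf , fhf , hff) (mg , hg , mhg , ghg , hgg) →
      ∘∈ M mf mg , hg ∘ hf , ∘∈ M mhg mhf
        , (λ a → trans (cong f (ghg (hf a))) (fhf a))
        , (λ a → trans (cong hg (hff (g a))) (hgg a))
  }

agree-∘ : {A : Set} (C : List A) (f g h h' : A → A) →
          Agree (map g C) f h → Agree C g h' → Agree C (f ∘ g) (h ∘ h')
agree-∘ Data.List.[] f g h h' _ _ = []
agree-∘ (a Data.List.∷ C) f g h h' (p ∷ ps) (q ∷ qs) =
  trans p (cong h q) ∷ agree-∘ C f g h h' ps qs

Closure : {A : Set} → TMonoid A → TMonoid A
Closure M = record
  { mem  = λ f → ∀ (C : List _) → ∃ λ h → mem M h × Agree C f h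
  ; resp = λ e m C → let (h , hm , ag) = m C in
      h , hm , All.map (λ {a} p → trans (sym (e a)) p) ag
  ; id∈  = λ C → id , id∈ M , All.universal (λ _ → refl) C
  ; ∘∈   = λ {f} {g} mf mg C →
      let (h' , h'm , ag') = mg C
          (h , hm , ag)    = mf (map g C)
      in h ∘ h' , ∘∈ M hm h'm , agree-∘ C f g h h' ag ag'
  }

Closed : {A : Set} → TMonoid A → Set
Closed M = ∀ f → mem (Closure M) f → mem M f

record MonoidIso {A B : Set} (M : TMonoid A) (N : TMonoid B) : Set where
  field
    fun  : Elem M → Elem N
    fun-cong : ∀ x y → proj₁ x ≗ proj₁ y → proj₁ (fun x) ≗ proj₁ (fun y)
    fun-hom  : ∀ x y → proj₁ (fun (proj₁ x ∘ proj₁ y , ∘∈ M (proj₂ x) (proj₂ y)))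
                   ≗ (proj₁ (fun x) ∘ proj₁ (fun y))
    fun-id : proj₁ (fun (id , id∈ M)) ≗ id
    fun-inj  : ∀ x y → proj₁ (fun x) ≗ proj₁ (fun y) → proj₁ x ≗ proj₁ y
    fun-surj : ∀ (y : Elem N) → ∃ λ (x : Elem M) → proj₁ (fun x) ≗ proj₁ y
open MonoidIso public

⟦_⟧ : {A B : Set} {M : TMonoid A} {N : TMonoid B} → MonoidIso M N → Elem M → B → B
⟦ θ ⟧ x = proj₁ (fun θ x)

Continuous : {A B : Set} {M : TMonoid A} {N : TMonoid B} → MonoidIso M N → Set
Continuous {A} {B} {M} θ =
  ∀ (x : Elem M) (D : List B) → ∃ λ (C : List A) →
    ∀ (y : Elem M) → Agree C (proj₁ x) (proj₁ y) → Agree D (⟦ θ ⟧ x) (⟦ θ ⟧ y)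

-- θ⁻¹ continuous (phrased via θ, which is a bijection)
InvContinuous : {A B : Set} {M : TMonoid A} {N : TMonoid B} → MonoidIso M N → Set
InvContinuous {A} {B} {M} θ =
  ∀ (x : Elem M) (C : List A) → ∃ λ (D : List B) →
    ∀ (y : Elem M) → Agree D (⟦ θ ⟧ x) (⟦ θ ⟧ y) → Agree C (proj₁ x) (proj₁ y)

Homeomorphism : {A B : Set} {M : TMonoid A} {N : TMonoid B} → MonoidIso M N → Set
Homeomorphism θ = Continuous θ × InvContinuous θ

UniformHomeomorphism : {A B : Set} {M : TMonoid A} {N : TMonoid B} → MonoidIso M N → Set
UniformHomeomorphism {A} {B} {M} θ =
  (∀ (D : List B) → ∃ λ (C : List A) → ∀ (x y : Elem M) →
      Agree C (proj₁ x) (proj₁ y) → Agree D (⟦ θ ⟧ x) (⟦ θ ⟧ y))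
  × (∀ (C : List A) → ∃ λ (D : List B) → ∀ (x y : Elem M) →
      Agree D (⟦ θ ⟧ x) (⟦ θ ⟧ y) → Agree C (proj₁ x) (proj₁ y))

Class : Set₂
Class = (B : Set) → TMonoid B → Set₁

AutoHomeo : {A : Set} → TMonoid A → Class → Set₁
AutoHomeo {A} F L =
  ∀ (B : Set) → A ↔ B → ∀ (F' : TMonoid B) → L B F' →
    ∀ (θ : MonoidIso F F') → Homeomorphism θ

UnitsClass : Class → Class
UnitsClass K B H = Σ (TMonoid B) λ N → K B N × SameMembers (Units N) H

ImageOfUnitsDense : {A B : Set} {M : TMonoid A} {N : TMonoid B} → MonoidIso M N → Set
ImageOfUnitsDense {A} {B} {M} {N} θ =
  ∀ (f : B → B) → mem N f → ∀ (D : List B) →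
    ∃ λ (g : Elem M) → Invertible M (proj₁ g) × Agree D f (⟦ θ ⟧ g)

CondA : Class → {A : Set} → TMonoid A → Set₁
CondA K {A} M =
  ∀ (B : Set) → A ↔ B → ∀ (M' : TMonoid B) → K B M' →
    ∀ (θ : MonoidIso M M') → ImageOfUnitsDense θ × UniformHomeomorphism θ

CondB : Class → {A : Set} → TMonoid A → Set₁
CondB K M = AutoHomeo M K

CondC : Class → {A : Set} → TMonoid A → Set₁
CondC K {A} M =
  ∀ (B : Set) → A ↔ B → ∀ (M' : TMonoid B) → Closed M' → K B M' →
    ∀ (θ : MonoidIso M M') → Continuous θ

CondD : Class → {A : Set} → TMonoid A → Set₁
CondD K {A} M =
  ∀ (B : Set) → A ↔ B → ∀ (M₁ M₂ : TMonoid B) → M₁ ⊆ₘ M₂ → K B M₁ → K B M₂ →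
    ∀ (φ₁ : MonoidIso M M₁) (φ₂ : MonoidIso M M₂) →
    (∀ (g : Elem M) → Invertible M (proj₁ g) → ⟦ φ₁ ⟧ g ≗ ⟦ φ₂ ⟧ g) →
    SameMembers M₁ M₂ × (∀ (x : Elem M) → ⟦ φ₁ ⟧ x ≗ ⟦ φ₂ ⟧ x)

module Submission where

-- (a) ⇒ (b) ⇒ (c) are immediate: uniform homeomorphisms are homeomorphisms,
-- and homeomorphisms are continuous.  (c) ⇒ (d): two continuous maps on M
-- that agree on the dense subset G agree everywhere.  (d) ⇒ (a) is the heart:
-- given θ : M ≅ M' with M' ∈ K, the restriction ψ of θ to the units is a
-- group isomorphism G(M) ≅ G(M') and hence a homeomorphism.  Isomorphisms of
-- unit groups are translation invariant, so continuity at the identity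
-- already gives uniform moduli of continuity (UniformModuli).  With these, ψ
-- extends by continuity to an isomorphism E : M ≅ closure(G(M')) agreeing
-- with θ on G; that closure lies in K and inside the closed monoid M', so (d)
-- applied to E and θ shows E = θ and closure(G(M')) = M'.  Density of θ[G]
-- and uniform continuity of θ are then inherited from E.

open import Defs
open import Data.Product using (_×_; Σ; _,_; proj₁; proj₂)
open import Function using (_∘_; id)
open import Data.List using (List; []; _∷_; _++_; map; concatMap)
open import Data.List.Relation.Unary.All using (All; []; _∷_)
import Data.List.Relation.Unary.All as All
import Data.List.Relation.Unary.All.Properties as AllP
open import Relation.Binary.PropositionalEquality
  using (_≡_; refl; sym; trans; cong; _≗_; module ≡-Reasoning)

agree-refl : {A : Set} (C : List A) {f : A → A} → Agree C f f
agree-refl C = All.universal (λ _ → refl) C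

agree-sym : {A : Set} {C : List A} {f g : A → A} → Agree C f g → Agree C g f
agree-sym = All.map sym

agree-trans : {A : Set} {C : List A} {f g h : A → A} →
              Agree C f g → Agree C g h → Agree C f h
agree-trans p q = All.zipWith (λ (e , e') → trans e e') (p , q)

agree-everywhere : {A : Set} (C : List A) {f g : A → A} → f ≗ g → Agree C f g
agree-everywhere C e = All.universal e C

agree-concatMap : {X A : Set} (c : X → List A) (D : List X) {f g : A → A} →
                  Agree (concatMap c D) f g → All (λ b → Agree (c b) f g) D
agree-concatMap c D ag = AllP.map⁻ (AllP.concat⁻ ag)

-- For an invertible f, the equation f a = g a is equivalent to
-- f⁻¹ (g a) = a; this lets us compare u and v through u⁻¹v.

shift-out : {X : Set} (f f⁻¹ g : X → X) → (f⁻¹ ∘ f) ≗ id →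
            ∀ a → f a ≡ g a → f⁻¹ (g a) ≡ a
shift-out f f⁻¹ g left a e = trans (cong f⁻¹ (sym e)) (left a)

shift-in : {X : Set} (f f⁻¹ g : X → X) → (f ∘ f⁻¹) ≗ id →
           ∀ a → f⁻¹ (g a) ≡ a → f a ≡ g a
shift-in f f⁻¹ g right a e = trans (cong f (sym e)) (right (g a))

module UnitGroup {A : Set} (M : TMonoid A) where

  forget : Elem (Units M) → Elem M
  forget (g , m , _) = g , m

  invertible : (u : Elem (Units M)) → Invertible M (proj₁ u)
  invertible (g , _ , g-inv) = g-inv

  unit-id : Elem (Units M)
  unit-id = id , id∈ (Units M)

  infixl 9 _∘ᵤ_
  _∘ᵤ_ : Elem (Units M) → Elem (Units M) → Elem (Units M)
  u ∘ᵤ v = proj₁ u ∘ proj₁ v , ∘∈ (Units M) (proj₂ u) (proj₂ v)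

  _⁻¹ᵤ : Elem (Units M) → Elem (Units M)
  (f , m , h , hm , fh , hf) ⁻¹ᵤ = h , hm , f , m , hf , fh

  right-inverse : (u : Elem (Units M)) → (proj₁ u ∘ proj₁ (u ⁻¹ᵤ)) ≗ id
  right-inverse (f , m , h , hm , fh , hf) = fh

  left-inverse : (u : Elem (Units M)) → (proj₁ (u ⁻¹ᵤ) ∘ proj₁ u) ≗ id
  left-inverse (f , m , h , hm , fh , hf) = hf

invertible-resp : {A : Set} (M : TMonoid A) {f g : A → A} →
                  f ≗ g → mem M f → Invertible M f → Invertible M g
invertible-resp M e m inv = proj₂ (resp (Units M) e (m , inv))

module IsoUnits {A B : Set} {M : TMonoid A} {N : TMonoid B}
                (θ : MonoidIso M N) where
  open UnitGroup M using (forget; invertible)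

  preserves-inverse : (x y : Elem M) → (proj₁ x ∘ proj₁ y) ≗ id →
                      (⟦ θ ⟧ x ∘ ⟦ θ ⟧ y) ≗ id
  preserves-inverse x y e a =
    trans (sym (fun-hom θ x y a))
      (trans (fun-cong θ (_ , ∘∈ M (proj₂ x) (proj₂ y)) (id , id∈ M) e a)
        (fun-id θ a))

  reflects-inverse : (x y : Elem M) → (⟦ θ ⟧ x ∘ ⟦ θ ⟧ y) ≗ id →
                     (proj₁ x ∘ proj₁ y) ≗ id
  reflects-inverse x y e =
    fun-inj θ (_ , ∘∈ M (proj₂ x) (proj₂ y)) (id , id∈ M)
      (λ a → trans (fun-hom θ x y a) (trans (e a) (sym (fun-id θ a))))

  unit-image : (x : Elem M) → Invertible M (proj₁ x) → Invertible N (⟦ θ ⟧ x)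
  unit-image x (h , hm , xh , hx) =
    ⟦ θ ⟧ (h , hm) , proj₂ (fun θ (h , hm))
    , preserves-inverse x (h , hm) xh , preserves-inverse (h , hm) x hx

  unit-preimage : (x : Elem M) → Invertible N (⟦ θ ⟧ x) → Invertible M (proj₁ x)
  unit-preimage x (v , vm , xv , vx) =
    proj₁ x' , proj₂ x'
    , reflects-inverse x x' (λ a → trans (cong (⟦ θ ⟧ x) (θx'≗v a)) (xv a))
    , reflects-inverse x' x (λ a → trans (θx'≗v (⟦ θ ⟧ x a)) (vx a))
    where
    x' = proj₁ (fun-surj θ (v , vm))
    θx'≗v = proj₂ (fun-surj θ (v , vm))

  restrictToUnits : MonoidIso (Units M) (Units N)
  restrictToUnits = record
    { fun      = λ u → ⟦ θ ⟧ (forget u) , proj₂ (fun θ (forget u))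
                                        , unit-image (forget u) (invertible u)
    ; fun-cong = λ u v → fun-cong θ (forget u) (forget v)
    ; fun-hom  = λ u v → fun-hom θ (forget u) (forget v)
    ; fun-id   = fun-id θ
    ; fun-inj  = λ u v → fun-inj θ (forget u) (forget v)
    ; fun-surj = λ w →
        let (x , θx≗w) = fun-surj θ (UnitGroup.forget N w)
            θx-unit = invertible-resp N (λ b → sym (θx≗w b))
                        (proj₂ (UnitGroup.forget N w)) (UnitGroup.invertible N w)
        in (proj₁ x , proj₂ x , unit-preimage x θx-unit) , θx≗w
    }

record UniformModuli {A B : Set} {M : TMonoid A} {N : TMonoid B}
                     (ψ : MonoidIso (Units M) (Units N)) : Set where
  field
    modulus  : B → List A
    modulus⁻ : A → List B
    uniform  : ∀ b (u v : Elem (Units M)) →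
               Agree (modulus b) (proj₁ u) (proj₁ v) → ⟦ ψ ⟧ u b ≡ ⟦ ψ ⟧ v b
    uniform⁻ : ∀ a (u v : Elem (Units M)) →
               Agree (modulus⁻ a) (⟦ ψ ⟧ u) (⟦ ψ ⟧ v) → proj₁ u a ≡ proj₁ v a

-- A homeomorphic isomorphism of unit groups is uniformly continuous in both
-- directions: u, v are close iff u⁻¹v is close to the identity, and ψ
-- commutes with forming u⁻¹v.
homeomorphism⇒uniformModuli :
  {A B : Set} {M : TMonoid A} {N : TMonoid B}
  (ψ : MonoidIso (Units M) (Units N)) → Homeomorphism ψ → UniformModuli ψ
homeomorphism⇒uniformModuli {A} {B} {M} ψ (cont , cont⁻) = record
  { modulus  = modulus
  ; modulus⁻ = modulus⁻
  ; uniform  = uniform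
  ; uniform⁻ = uniform⁻
  }
  where
  open IsoUnits ψ using (preserves-inverse)
  open UnitGroup M
  e = unit-id

  modulus : B → List A
  modulus b = proj₁ (cont e (b ∷ []))

  modulus⁻ : A → List B
  modulus⁻ a = proj₁ (cont⁻ e (a ∷ []))

  ψ-difference : ∀ b u v → ⟦ ψ ⟧ (u ⁻¹ᵤ ∘ᵤ v) b ≡ b → ⟦ ψ ⟧ u b ≡ ⟦ ψ ⟧ v b
  ψ-difference b u v fixes =
    shift-in (⟦ ψ ⟧ u) (⟦ ψ ⟧ (u ⁻¹ᵤ)) (⟦ ψ ⟧ v)
      (preserves-inverse u (u ⁻¹ᵤ) (right-inverse u))
      b (trans (sym (fun-hom ψ (u ⁻¹ᵤ) v b)) fixes)

  ψ-difference⁻ : ∀ b u v → ⟦ ψ ⟧ u b ≡ ⟦ ψ ⟧ v b → ⟦ ψ ⟧ (u ⁻¹ᵤ ∘ᵤ v) b ≡ b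
  ψ-difference⁻ b u v agree =
    trans (fun-hom ψ (u ⁻¹ᵤ) v b)
      (shift-out (⟦ ψ ⟧ u) (⟦ ψ ⟧ (u ⁻¹ᵤ)) (⟦ ψ ⟧ v)
         (preserves-inverse (u ⁻¹ᵤ) u (left-inverse u)) b agree)

  uniform : ∀ b u v → Agree (modulus b) (proj₁ u) (proj₁ v) → ⟦ ψ ⟧ u b ≡ ⟦ ψ ⟧ v b
  uniform b u v ag = ψ-difference b u v
    (trans (sym (All.head (proj₂ (cont e (b ∷ [])) (u ⁻¹ᵤ ∘ᵤ v) near-id)))
           (fun-id ψ b))
    where
    near-id : Agree (modulus b) id (proj₁ (u ⁻¹ᵤ ∘ᵤ v))
    near-id = All.map
      (λ {a} → sym ∘ shift-out (proj₁ u) (proj₁ (u ⁻¹ᵤ)) (proj₁ v) (left-inverse u) a) ag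

  uniform⁻ : ∀ a u v → Agree (modulus⁻ a) (⟦ ψ ⟧ u) (⟦ ψ ⟧ v) → proj₁ u a ≡ proj₁ v a
  uniform⁻ a u v ag =
    shift-in (proj₁ u) (proj₁ (u ⁻¹ᵤ)) (proj₁ v) (right-inverse u) a
      (sym (All.head (proj₂ (cont⁻ e (a ∷ [])) (u ⁻¹ᵤ ∘ᵤ v) near-id)))
    where
    near-id : Agree (modulus⁻ a) (⟦ ψ ⟧ e) (⟦ ψ ⟧ (u ⁻¹ᵤ ∘ᵤ v))
    near-id = All.map (λ {b} agb → trans (fun-id ψ b) (sym (ψ-difference⁻ b u v agb))) ag

UnitsDense : {A : Set} → TMonoid A → Set
UnitsDense M = ∀ f → mem M f → mem (Closure (Units M)) f

approximant : {A : Set} (M : TMonoid A) → UnitsDense M →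
              (x : Elem M) (C : List A) →
              Σ (Elem (Units M)) λ u → Agree C (proj₁ x) (proj₁ u)
approximant M dense (f , m) C =
  let (g , g-unit , f≈g) = dense f m C in (g , g-unit) , f≈g

continuous-agree-on-units⇒equal :
  {A B : Set} {M : TMonoid A} {N₁ N₂ : TMonoid B} → UnitsDense M →
  (φ₁ : MonoidIso M N₁) (φ₂ : MonoidIso M N₂) → Continuous φ₁ → Continuous φ₂ →
  (∀ (g : Elem M) → Invertible M (proj₁ g) → ⟦ φ₁ ⟧ g ≗ ⟦ φ₂ ⟧ g) →
  ∀ (x : Elem M) → ⟦ φ₁ ⟧ x ≗ ⟦ φ₂ ⟧ x
continuous-agree-on-units⇒equal {M = M} dense φ₁ φ₂ cont₁ cont₂ on-units x b =
  begin
    ⟦ φ₁ ⟧ x b ≡⟨ All.head (proj₂ (cont₁ x (b ∷ [])) u' (AllP.++⁻ˡ C₁ x≈u)) ⟩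
    ⟦ φ₁ ⟧ u' b ≡⟨ on-units u' (UnitGroup.invertible M u) b ⟩
    ⟦ φ₂ ⟧ u' b ≡⟨ All.head (proj₂ (cont₂ x (b ∷ [])) u' (AllP.++⁻ʳ C₁ x≈u)) ⟨
    ⟦ φ₂ ⟧ x b ∎
  where
  open ≡-Reasoning
  C₁ = proj₁ (cont₁ x (b ∷ []))
  C₂ = proj₁ (cont₂ x (b ∷ []))
  u = proj₁ (approximant M dense x (C₁ ++ C₂))
  x≈u = proj₂ (approximant M dense x (C₁ ++ C₂))
  u' = UnitGroup.forget M u

equal-isos⇒same-members :
  {A B : Set} {M : TMonoid A} {M₁ M₂ : TMonoid B} → M₁ ⊆ₘ M₂ →
  (φ₁ : MonoidIso M M₁) (φ₂ : MonoidIso M M₂) →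
  (∀ (x : Elem M) → ⟦ φ₁ ⟧ x ≗ ⟦ φ₂ ⟧ x) → SameMembers M₁ M₂
equal-isos⇒same-members {M₁ = M₁} {M₂} M₁⊆M₂ φ₁ φ₂ φ₁≗φ₂ = M₁⊆M₂ , M₂⊆M₁
  where
  M₂⊆M₁ : M₂ ⊆ₘ M₁
  M₂⊆M₁ f f∈M₂ =
    let (x , φ₂x≗f) = fun-surj φ₂ (f , f∈M₂)
    in resp M₁ (λ a → trans (φ₁≗φ₂ x a) (φ₂x≗f a)) (proj₂ (fun φ₁ x))

-- If G(M) is dense in M and ψ : G(M) ≅ G(N) has
-- uniform moduli, then ψ extends to a uniformly bicontinuous isomorphism
-- from M (when M is closed) onto the closure of G(N): the extension sends x
-- to the map whose value at b is ψ u b for any unit u agreeing with x on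
-- modulus b.
module Extension {A B : Set} {M : TMonoid A} {N : TMonoid B}
                 (dense : UnitsDense M)
                 {ψ : MonoidIso (Units M) (Units N)} (moduli : UniformModuli ψ) where
  open UniformModuli moduli
  open UnitGroup M
  open ≡-Reasoning

  approx : (x : Elem M) (C : List A) →
           Σ (Elem (Units M)) λ u → Agree C (proj₁ x) (proj₁ u)
  approx = approximant M dense

  ext : Elem M → B → B
  ext x b = ⟦ ψ ⟧ (proj₁ (approx x (modulus b))) b

  ext-agrees : ∀ x b (u : Elem (Units M)) →
               Agree (modulus b) (proj₁ x) (proj₁ u) → ext x b ≡ ⟦ ψ ⟧ u b
  ext-agrees x b u x≈u =
    let (v , x≈v) = approx x (modulus b)
    in uniform b v u (agree-trans (agree-sym x≈v) x≈u)

  ext-agrees* : ∀ x (D : List B) (u : Elem (Units M)) →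
                Agree (concatMap modulus D) (proj₁ x) (proj₁ u) →
                Agree D (ext x) (⟦ ψ ⟧ u)
  ext-agrees* x D u x≈u =
    All.map (λ {b} → ext-agrees x b u) (agree-concatMap modulus D x≈u)

  ext-extends : ∀ (u : Elem (Units M)) → ext (forget u) ≗ ⟦ ψ ⟧ u
  ext-extends u b = ext-agrees (forget u) b u (agree-refl (modulus b))

  ext-local : ∀ x y b → Agree (modulus b) (proj₁ x) (proj₁ y) → ext x b ≡ ext y b
  ext-local x y b x≈y =
    let (v , y≈v) = approx y (modulus b)
    in ext-agrees x b v (agree-trans x≈y y≈v)

  ext-reflects : ∀ x y a → Agree (modulus⁻ a) (ext x) (ext y) → proj₁ x a ≡ proj₁ y a
  ext-reflects x y a ext≈ext =
    begin
      proj₁ x a ≡⟨ All.head x≈u ⟩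
      proj₁ u a ≡⟨ uniform⁻ a u v ψu≈ψv ⟩
      proj₁ v a ≡⟨ All.head y≈v ⟨
      proj₁ y a ∎
    where
    C = a ∷ concatMap modulus (modulus⁻ a)
    u = proj₁ (approx x C)
    x≈u = proj₂ (approx x C)
    v = proj₁ (approx y C)
    y≈v = proj₂ (approx y C)
    ψu≈ψv : Agree (modulus⁻ a) (⟦ ψ ⟧ u) (⟦ ψ ⟧ v)
    ψu≈ψv = agree-trans (agree-sym (ext-agrees* x (modulus⁻ a) u (All.tail x≈u)))
              (agree-trans ext≈ext (ext-agrees* y (modulus⁻ a) v (All.tail y≈v)))

  ext-in-closure : ∀ x → mem (Closure (Units N)) (ext x)
  ext-in-closure x D =
    let (u , x≈u) = approx x (concatMap modulus D)
    in ⟦ ψ ⟧ u , proj₂ (fun ψ u) , ext-agrees* x D u x≈u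

  ext-id : ext (id , id∈ M) ≗ id
  ext-id b = trans (ext-extends unit-id b) (fun-id ψ b)

  ext-hom : ∀ x y → ext (proj₁ x ∘ proj₁ y , ∘∈ M (proj₂ x) (proj₂ y)) ≗ (ext x ∘ ext y)
  ext-hom x y b =
    begin
      ext xy b              ≡⟨ ext-agrees xy b (u ∘ᵤ v) xy≈uv ⟩
      ⟦ ψ ⟧ (u ∘ᵤ v) b       ≡⟨ fun-hom ψ u v b ⟩
      ⟦ ψ ⟧ u (⟦ ψ ⟧ v b)    ≡⟨ cong (⟦ ψ ⟧ u) (ext-agrees y b v y≈v) ⟨
      ⟦ ψ ⟧ u (ext y b)      ≡⟨ ext-agrees x (ext y b) u (AllP.++⁻ˡ C x≈u) ⟨
      ext x (ext y b) ∎
    where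
    xy = proj₁ x ∘ proj₁ y , ∘∈ M (proj₂ x) (proj₂ y)
    v = proj₁ (approx y (modulus b))
    y≈v = proj₂ (approx y (modulus b))
    C = modulus (ext y b)
    u = proj₁ (approx x (C ++ map (proj₁ y) (modulus b)))
    x≈u = proj₂ (approx x (C ++ map (proj₁ y) (modulus b)))
    xy≈uv : Agree (modulus b) (proj₁ xy) (proj₁ (u ∘ᵤ v))
    xy≈uv = agree-∘ (modulus b) (proj₁ x) (proj₁ y) (proj₁ u) (proj₁ v)
              (AllP.++⁻ʳ C x≈u) y≈v

  pullback : ∀ f → mem (Closure (Units N)) f → (D : List B) →
             Σ (Elem (Units M)) λ u → Agree D f (⟦ ψ ⟧ u)
  pullback f f∈cl D =
    let (w , w-unit , f≈w) = f∈cl D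
        (u , ψu≗w) = fun-surj ψ (w , w-unit)
    in u , agree-trans f≈w (agree-everywhere D (λ b → sym (ψu≗w b)))

  -- Every f in the closure of G(N) has a preimage under ext: its value at a
  -- is u a for any unit u with ψ u close to f on modulus⁻ a.
  module Preimage (f : B → B) (f∈cl : mem (Closure (Units N)) f) where

    preimage : A → A
    preimage a = proj₁ (proj₁ (pullback f f∈cl (modulus⁻ a))) a

    preimage-agrees : ∀ C (u : Elem (Units M)) →
                      Agree (concatMap modulus⁻ C) f (⟦ ψ ⟧ u) → Agree C preimage (proj₁ u)
    preimage-agrees C u f≈ψu =
      All.map (λ {a} f≈ψu-near-a →
                 let (uₐ , f≈ψuₐ) = pullback f f∈cl (modulus⁻ a)
                 in uniform⁻ a uₐ u (agree-trans (agree-sym f≈ψuₐ) f≈ψu-near-a))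
              (agree-concatMap modulus⁻ C f≈ψu)

    preimage∈M : Closed M → mem M preimage
    preimage∈M closed = closed preimage λ C →
      let (u , f≈ψu) = pullback f f∈cl (concatMap modulus⁻ C)
      in proj₁ u , proj₁ (proj₂ u) , preimage-agrees C u f≈ψu

    ext-preimage : (closed : Closed M) → ext (preimage , preimage∈M closed) ≗ f
    ext-preimage closed b =
      let (u , f≈ψu) = pullback f f∈cl (b ∷ concatMap modulus⁻ (modulus b))
      in trans (ext-agrees (preimage , preimage∈M closed) b u
                  (preimage-agrees (modulus b) u (All.tail f≈ψu)))
               (sym (All.head f≈ψu))

  open Preimage

  extension : Closed M → MonoidIso M (Closure (Units N))
  extension closed = record
    { fun      = λ x → ext x , ext-in-closure x
    ; fun-cong = λ x y x≗y b → ext-local x y b (agree-everywhere (modulus b) x≗y)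
    ; fun-hom  = ext-hom
    ; fun-id   = ext-id
    ; fun-inj  = λ x y ext≗ext a → ext-reflects x y a (agree-everywhere (modulus⁻ a) ext≗ext)
    ; fun-surj = λ (f , f∈cl) →
        (preimage f f∈cl , preimage∈M f f∈cl closed) , ext-preimage f f∈cl closed
    }

  extension-uniform : (closed : Closed M) → UniformHomeomorphism (extension closed)
  extension-uniform closed =
      (λ D → concatMap modulus D , λ x y x≈y →
         All.map (λ {b} → ext-local x y b) (agree-concatMap modulus D x≈y))
    , (λ C → concatMap modulus⁻ C , λ x y ext≈ext →
         All.map (λ {a} → ext-reflects x y a) (agree-concatMap modulus⁻ C ext≈ext))

uniform⇒homeomorphism : {A B : Set} {M : TMonoid A} {N : TMonoid B}
                        (θ : MonoidIso M N) → UniformHomeomorphism θ → Homeomorphism θ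
uniform⇒homeomorphism θ (unif , unif⁻) =
    (λ x D → proj₁ (unif D) , proj₂ (unif D) x)
  , (λ x C → proj₁ (unif⁻ C) , proj₂ (unif⁻ C) x)

uniform-transport : {A B : Set} {M : TMonoid A} {N₁ N₂ : TMonoid B}
                    (φ₁ : MonoidIso M N₁) (φ₂ : MonoidIso M N₂) →
                    (∀ (x : Elem M) → ⟦ φ₁ ⟧ x ≗ ⟦ φ₂ ⟧ x) →
                    UniformHomeomorphism φ₁ → UniformHomeomorphism φ₂
uniform-transport φ₁ φ₂ φ₁≗φ₂ (unif , unif⁻) =
    (λ D → proj₁ (unif D) , λ x y x≈y →
       agree-trans (agree-sym (same x D)) (agree-trans (proj₂ (unif D) x y x≈y) (same y D)))
  , (λ C → proj₁ (unif⁻ C) , λ x y φ₂x≈φ₂y →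
       proj₂ (unif⁻ C) x y
         (agree-trans (same x _) (agree-trans φ₂x≈φ₂y (agree-sym (same y _)))))
  where
  same : ∀ x D → Agree D (⟦ φ₁ ⟧ x) (⟦ φ₂ ⟧ x)
  same x D = agree-everywhere D (φ₁≗φ₂ x)

closure-units⊆ : {B : Set} (N : TMonoid B) → Closed N → Closure (Units N) ⊆ₘ N
closure-units⊆ N closed f f∈cl = closed f λ D →
  let (g , (g∈N , _) , f≈g) = f∈cl D in g , g∈N , f≈g

units∈UnitsClass : (K : Class) {B : Set} {N : TMonoid B} → K B N → UnitsClass K B (Units N)
units∈UnitsClass K {N = N} N∈K = N , N∈K , (λ _ f∈G → f∈G) , (λ _ f∈G → f∈G)

condC⇒condD : (K : Class) → (∀ (B : Set) (N : TMonoid B) → K B N → Closed N) →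
              {A : Set} {M : TMonoid A} → UnitsDense M → CondC K M → CondD K M
condC⇒condD K closedK {M = M} dense condC B A↔B M₁ M₂ M₁⊆M₂ M₁∈K M₂∈K φ₁ φ₂ on-units =
  equal-isos⇒same-members M₁⊆M₂ φ₁ φ₂ φ₁≗φ₂ , φ₁≗φ₂
  where
  φ₁≗φ₂ : ∀ (x : Elem M) → ⟦ φ₁ ⟧ x ≗ ⟦ φ₂ ⟧ x
  φ₁≗φ₂ = continuous-agree-on-units⇒equal dense φ₁ φ₂
            (condC B A↔B M₁ (closedK B M₁ M₁∈K) M₁∈K φ₁)
            (condC B A↔B M₂ (closedK B M₂ M₂∈K) M₂∈K φ₂) on-units

condD⇒condA : (K : Class) → (∀ (B : Set) (N : TMonoid B) → K B N → Closed N) →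
              (∀ (B : Set) (H : TMonoid B) → UnitsClass K B H → K B (Closure H)) →
              {A : Set} {M : TMonoid A} → Closed M → UnitsDense M →
              AutoHomeo (Units M) (UnitsClass K) → CondD K M → CondA K M
condD⇒condA K closedK closK {M = M} closed dense autoHomeo condD B A↔B M' M'∈K θ =
  image-dense , uniform-transport E θ E≗θ (extension-uniform closed)
  where
  ψ : MonoidIso (Units M) (Units M')
  ψ = IsoUnits.restrictToUnits θ

  G'∈𝒢 : UnitsClass K B (Units M')
  G'∈𝒢 = units∈UnitsClass K M'∈K

  open Extension dense (homeomorphism⇒uniformModuli ψ (autoHomeo B A↔B (Units M') G'∈𝒢 ψ))
  open UnitGroup M using (forget; invertible)

  E : MonoidIso M (Closure (Units M'))
  E = extension closed

  E=θ : SameMembers (Closure (Units M')) M' × (∀ (x : Elem M) → ⟦ E ⟧ x ≗ ⟦ θ ⟧ x)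
  E=θ = condD B A↔B (Closure (Units M')) M' (closure-units⊆ M' (closedK B M' M'∈K))
          (closK B (Units M') G'∈𝒢) M'∈K E θ
          (λ g g-inv → ext-extends (proj₁ g , proj₂ g , g-inv))

  E≗θ : ∀ (x : Elem M) → ⟦ E ⟧ x ≗ ⟦ θ ⟧ x
  E≗θ = proj₂ E=θ

  image-dense : ImageOfUnitsDense θ
  image-dense f f∈M' D =
    let (u , f≈θu) = pullback f (proj₂ (proj₁ E=θ) f f∈M') D
    in forget u , invertible u , f≈θu

proposition3p3 : (K : Class) →
    (∀ (B : Set) (N : TMonoid B) → K B N → Closed N) →
    (∀ (B : Set) (N N' : TMonoid B) → SameMembers N N' → K B N → K B N') →
    (∀ (B : Set) (H : TMonoid B) → UnitsClass K B H → K B (Closure H)) →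
    (A : Set) (M : TMonoid A) →
    Closed M →
    (∀ (f : A → A) → mem M f → mem (Closure (Units M)) f) →
    AutoHomeo (Units M) (UnitsClass K) →
    (CondA K M → CondB K M) × (CondB K M → CondC K M)
    × (CondC K M → CondD K M) × (CondD K M → CondA K M)
proposition3p3 K closedK _ closK A M closed dense autoHomeo =
    (λ condA B A↔B M' M'∈K θ → uniform⇒homeomorphism θ (proj₂ (condA B A↔B M' M'∈K θ)))
  , (λ condB B A↔B M' _ M'∈K θ → proj₁ (condB B A↔B M' M'∈K θ))
  , condC⇒condD K closedK dense
  , condD⇒condA K closedK closK closed dense autoHomeo
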